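{- Let $k\ge 4$ and $t\ge 1$ be integers and suppose the tower $T_{k,t}$ has a proper $(k-1)$-coloring $f$ with $f(v_{0,1})=f(v_{0,0})$. Then $f(v_{i,1})=f(v_{i,0})$ for every $1\le i\le t$.
   Context: The tower $T_{k,t}$ has vertex set $V_0\cup V_1\cup\dots\cup V_t$ with $V_0=\{v_{0,0},v_{0,1}\}$ and $V_i=\{v_{i,0},\dots,v_{i,k-2}\}$ for $1\le i\le t$; for $1\le i\le t$, $V_i$ induces $K_{k-1}$ minus the edge $v_{i,0}v_{i,1}$, the vertex $v_{i-1,0}$ is adjacent to $v_{i,j}$ for all $0\le j\le (k-2)/2$, and $v_{i-1,1}$ is adjacent to $v_{i,j}$ for all $(k-1)/2\le j\le k-2$; there are no other edges. -}

module Defs where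

open import Data.Nat using (ℕ; zero; suc; _∸_; _*_; _≤_; _<_; s≤s; z≤n)
open import Data.Nat.Properties using (≤-trans; m≤n⇒m≤1+n)
open import Data.Fin using (Fin)
open import Data.Product using (_×_)
open import Data.Sum using (_⊎_)
open import Relation.Binary.PropositionalEquality using (_≡_; _≢_)
open import Relation.Nullary using (¬_)

-- Vertices of the tower T_{k,t}: vertex v_{i,j} is  mkV i j  with
-- 0 ≤ i ≤ t, j ∈ {0,1} if i = 0, and 0 ≤ j ≤ k-2 if i ≥ 1.
-- Validity proofs are irrelevant, so vertices are determined by (i , j).
data V (k t : ℕ) : Set where
  mkV : (i j : ℕ) → .(i ≤ t) → .(i ≡ 0 → j < 2) → .(1 ≤ i → j ≤ k ∸ 2) → V k t

-- Directed edge description (from v_{i,j} to v_{i',j'}):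
--  * inside a level V_i (i ≥ 1): j ≠ j' and {j,j'} ≠ {0,1}  (K_{k-1} minus v_{i,0}v_{i,1});
--  * v_{i-1,0} -- v_{i,j'} whenever j' ≤ (k-2)/2, i.e. 2 j' ≤ k-2;
--  * v_{i-1,1} -- v_{i,j'} whenever (k-1)/2 ≤ j', i.e. k-1 ≤ 2 j'.
Edge : (k i j i' j' : ℕ) → Set
Edge k i j i' j' =
    (i ≡ i' × 1 ≤ i × j ≢ j' × ¬ ((j ≡ 0 × j' ≡ 1) ⊎ (j ≡ 1 × j' ≡ 0)))
  ⊎ (suc i ≡ i' × ((j ≡ 0 × 2 * j' ≤ k ∸ 2) ⊎ (j ≡ 1 × k ∸ 1 ≤ 2 * j')))

Adj : {k t : ℕ} → V k t → V k t → Set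
Adj {k} (mkV i j _ _ _) (mkV i' j' _ _ _) = Edge k i j i' j' ⊎ Edge k i' j' i j

Proper : {k t : ℕ} {C : Set} → (V k t → C) → Set
Proper {k} {t} f = (u w : V k t) → Adj u w → f u ≢ f w

private
  j<2⇒ : {j k : ℕ} → j < 2 → 4 ≤ k → j ≤ k ∸ 2
  j<2⇒ {zero} _ _ = z≤n
  j<2⇒ {suc zero} _ (s≤s (s≤s (s≤s (s≤s _)))) = s≤s z≤n
  j<2⇒ {suc (suc j)} (s≤s (s≤s ()))

v : (k t i j : ℕ) → 4 ≤ k → i ≤ t → j < 2 → V k t
v k t i j k≥4 i≤t j<2 = mkV i j i≤t (λ _ → j<2) (λ _ → j<2⇒ j<2 k≥4)

-- If v_{p,0} and v_{p,1} share a colour c, then every vertex of level p+1 is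
-- adjacent to one of them, so level p+1 is coloured from the k-2 colours other
-- than c. Its k-1 vertices form K_{k-1} minus the edge v_{p+1,0}v_{p+1,1}; were
-- those two coloured differently, all k-1 colours would be distinct, which the
-- pigeonhole principle forbids.
module Submission where

open import Defs
open import Data.Nat using (ℕ; zero; suc; _+_; _*_; _∸_; _≤_; _≤?_; z≤n; s≤s)
open import Data.Nat.Properties using (<⇒≤; <⇒≢; ≰⇒>)
import Data.Nat.Properties as ℕ
open import Data.Fin as Fin using (Fin; toℕ; punchOut)
open import Data.Fin.Properties using (_≟_; toℕ≤pred[n]; pigeonhole; punchOut-injective)
open import Data.Product using (_,_; _×_; ∃₂)
open import Data.Sum using (_⊎_; inj₁; inj₂)
open import Data.Empty using (⊥-elim)
open import Function using (_∘_)
open import Relation.Nullary using (¬_; Dec; yes; no)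
open import Relation.Nullary.Decidable using (_×-dec_; _⊎-dec_)
open import Relation.Binary.PropositionalEquality using (_≡_; _≢_; refl; sym; trans)

MissingEdge : ℕ → ℕ → Set
MissingEdge j j' = (j ≡ 0 × j' ≡ 1) ⊎ (j ≡ 1 × j' ≡ 0)

missingEdge? : (j j' : ℕ) → Dec (MissingEdge j j')
missingEdge? j j' = (j ℕ.≟ 0 ×-dec j' ℕ.≟ 1) ⊎-dec (j ℕ.≟ 1 ×-dec j' ℕ.≟ 0)

module _ {n t : ℕ} {f : V (4 + n) t → Fin (3 + n)} (proper : Proper f) where

  4≤k : 4 ≤ 4 + n
  4≤k = s≤s (s≤s (s≤s (s≤s z≤n)))

  v₀ v₁ : (i : ℕ) → i ≤ t → V (4 + n) t
  v₀ i i≤t = v (4 + n) t i 0 4≤k i≤t (s≤s z≤n)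
  v₁ i i≤t = v (4 + n) t i 1 4≤k i≤t (s≤s (s≤s z≤n))

  -- v_{p+1,j}: indexing levels by their predecessor builds in 1 ≤ i.
  upper : (p j : ℕ) → suc p ≤ t → j ≤ 2 + n → V (4 + n) t
  upper p j p<t j≤ = mkV (suc p) j p<t (λ ()) (λ _ → j≤)

  Twins : (i : ℕ) → i ≤ t → Set
  Twins i i≤t = f (v₁ i i≤t) ≡ f (v₀ i i≤t)

  upper-avoids-twin-colour : (p : ℕ) (p<t : suc p ≤ t) → Twins p (<⇒≤ p<t)
    → (j : ℕ) (j≤ : j ≤ 2 + n) → f (v₀ p (<⇒≤ p<t)) ≢ f (upper p j p<t j≤)
  upper-avoids-twin-colour p p<t twins j j≤ with 2 * j ≤? 2 + n
  ... | yes low = proper (v₀ p p≤t) (upper p j p<t j≤) (inj₁ (inj₂ (refl , inj₁ (refl , low))))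
    where p≤t = <⇒≤ p<t
  ... | no ¬low = proper (v₁ p p≤t) (upper p j p<t j≤) (inj₁ (inj₂ (refl , inj₂ (refl , ≰⇒> ¬low))))
                ∘ trans twins
    where p≤t = <⇒≤ p<t

  upper-distinct : (p : ℕ) (p<t : suc p ≤ t) → ¬ Twins (suc p) p<t
    → (j j' : ℕ) (j≤ : j ≤ 2 + n) (j'≤ : j' ≤ 2 + n) → j ≢ j'
    → f (upper p j p<t j≤) ≢ f (upper p j' p<t j'≤)
  upper-distinct p p<t differ j j' j≤ j'≤ j≢j' with missingEdge? j j'
  ... | yes (inj₁ (refl , refl)) = differ ∘ sym
  ... | yes (inj₂ (refl , refl)) = differ
  ... | no ¬missing = proper _ _ (inj₁ (inj₁ (refl , s≤s z≤n , j≢j' , ¬missing)))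

  twins-step : (p : ℕ) (p<t : suc p ≤ t) → Twins p (<⇒≤ p<t) → Twins (suc p) p<t
  twins-step p p<t twins with f (v₁ (suc p) p<t) ≟ f (v₀ (suc p) p<t)
  ... | yes same = same
  ... | no differ = ⊥-elim (noCollision (pigeonhole ℕ.≤-refl reducedColour))
    where
    vertex : Fin (3 + n) → V (4 + n) t
    vertex m = upper p (toℕ m) p<t (toℕ≤pred[n] m)
    avoids : (m : Fin (3 + n)) → f (v₀ p (<⇒≤ p<t)) ≢ f (vertex m)
    avoids m = upper-avoids-twin-colour p p<t twins (toℕ m) (toℕ≤pred[n] m)
    reducedColour : Fin (3 + n) → Fin (2 + n)
    reducedColour m = punchOut (avoids m)
    noCollision : ¬ ∃₂ (λ m m' → m Fin.< m' × reducedColour m ≡ reducedColour m')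
    noCollision (m , m' , m<m' , collide) =
      upper-distinct p p<t differ (toℕ m) (toℕ m')
        (toℕ≤pred[n] m) (toℕ≤pred[n] m') (<⇒≢ m<m')
        (punchOut-injective (avoids m) (avoids m') collide)

  twins-everywhere : Twins 0 z≤n → (p : ℕ) (p<t : suc p ≤ t) → Twins (suc p) p<t
  twins-everywhere base zero    p<t = twins-step zero p<t base
  twins-everywhere base (suc p) p<t = twins-step (suc p) p<t (twins-everywhere base p (<⇒≤ p<t))

lemma4p2 : (k t : ℕ) (k≥4 : 4 ≤ k) (t≥1 : 1 ≤ t)
    → (f : V k t → Fin (k ∸ 1)) → Proper f
    → f (v k t 0 1 k≥4 z≤n (s≤s (s≤s z≤n))) ≡ f (v k t 0 0 k≥4 z≤n (s≤s z≤n))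
    → (i : ℕ) → 1 ≤ i → (i≤t : i ≤ t)
    → f (v k t i 1 k≥4 i≤t (s≤s (s≤s z≤n))) ≡ f (v k t i 0 k≥4 i≤t (s≤s z≤n))
lemma4p2 .(4 + n) t (s≤s (s≤s (s≤s (s≤s {n = n} z≤n)))) _ f proper base (suc p) _ i≤t =
  twins-everywhere proper base p i≤t
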